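{- Let $\mathcal{B}_{\mathcal{G}_2}$ be the set of partitions $\lambda=(\lambda_1,\ldots,\lambda_\ell)$ whose odd-indexed parts are even and which satisfy $1\le\lambda_i-\lambda_{i+1}\le 2$ for all $1\le i\le\ell$ (with $\lambda_{\ell+1}=0$). For integers $m\ge0$ and $h$, let $B_{\mathcal{G}_2}(m,h)=\sum\omega(\lambda)$, the sum over $\lambda\in\mathcal{B}_{\mathcal{G}_2}$ with $\ell(\lambda)=m$ and $\lambda_1=h$. Then for all positive integers $n$ and $h$: $$B_{\mathcal{G}_2}(2n-1,2h)=Q^{\binom{n+1}{2}+\binom{h-n+1}{2}}c^{n-h-1}d^{ -n}{n-1\brack h-n}_{Q},$$ $$B_{\mathcal{G}_2}(2n,2h)=Q^{\binom{n+1}{2}+\binom{h-n+1}{2}}c^{n-h}d^{ -n}{n\brack h-n}_{Q}.$$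
   Context: Partitions are finite weakly decreasing sequences of positive integers; $\ell(\lambda)$ is the length and $\lambda_i=0$ for $i>\ell(\lambda)$. The four-parameter weight is $\omega(\lambda)=a^{\sum_{i\ge1}\lceil\lambda_{2i-1}/2\rceil}b^{\sum_{i\ge1}\lfloor\lambda_{2i-1}/2\rfloor}c^{\sum_{i\ge1}\lceil\lambda_{2i}/2\rceil}d^{\sum_{i\ge1}\lfloor\lambda_{2i}/2\rfloor}$, and $Q=abcd$ (the right-hand sides are rational functions, equal to polynomials when nonzero). The $Q$-binomial coefficient is ${N\brack k}_Q=\frac{(Q;Q)_N}{(Q;Q)_k(Q;Q)_{N-k}}$ for $0\le k\le N$ and $0$ otherwise, where $(Q;Q)_N=\prod_{i=1}^{N}(1-Q^i)$; $\binom{m}{2}=m(m-1)/2$ for any integer $m$. -}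

module Defs where

open import Level using (Level)
open import Data.Bool using (Bool; true; false; _∧_; if_then_else_)
open import Data.Nat.Base using (ℕ; zero; suc; _+_; _*_; _∸_; _≤ᵇ_; _≡ᵇ_; ⌊_/2⌋; ⌈_/2⌉)
open import Data.Integer.Base using (ℤ; +_; -[1+_])
open import Data.List.Base using (List; []; _∷_; map; concatMap; filter; foldr; upTo; length)
open import Algebra.Bundles using (CommutativeRing)
open import Relation.Nullary.Decidable using (Dec)
open import Relation.Binary.PropositionalEquality using (_≡_)
open import Data.Bool.Properties using (_≟_)

evenᵇ : ℕ → Bool
evenᵇ zero          = true
evenᵇ (suc zero)    = false
evenᵇ (suc (suc n)) = evenᵇ n

decreasingᵇ : List ℕ → Bool
decreasingᵇ []           = true
decreasingᵇ (x ∷ [])     = true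
decreasingᵇ (x ∷ y ∷ ys) = (y ≤ᵇ x) ∧ decreasingᵇ (y ∷ ys)

allPositiveᵇ : List ℕ → Bool
allPositiveᵇ []       = true
allPositiveᵇ (x ∷ xs) = (1 ≤ᵇ x) ∧ allPositiveᵇ xs

isPartitionᵇ : List ℕ → Bool
isPartitionᵇ xs = decreasingᵇ xs ∧ allPositiveᵇ xs

mutual
  oddIndexedEvenᵇ : List ℕ → Bool
  oddIndexedEvenᵇ []       = true
  oddIndexedEvenᵇ (x ∷ xs) = evenᵇ x ∧ evenIndexedSkipᵇ xs

  evenIndexedSkipᵇ : List ℕ → Bool
  evenIndexedSkipᵇ []       = true
  evenIndexedSkipᵇ (x ∷ xs) = oddIndexedEvenᵇ xs

gapOKᵇ : ℕ → ℕ → Bool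
gapOKᵇ x y = (suc y ≤ᵇ x) ∧ (x ≤ᵇ y + 2)

gapsOKᵇ : List ℕ → Bool
gapsOKᵇ []           = true
gapsOKᵇ (x ∷ [])     = gapOKᵇ x 0
gapsOKᵇ (x ∷ y ∷ ys) = gapOKᵇ x y ∧ gapsOKᵇ (y ∷ ys)

inBG2ᵇ : List ℕ → Bool
inBG2ᵇ xs = isPartitionᵇ xs ∧ oddIndexedEvenᵇ xs ∧ gapsOKᵇ xs

-- λ₁ = h  (λ₁ = 0 for the empty partition)
firstPartIsᵇ : ℕ → List ℕ → Bool
firstPartIsᵇ h []      = h ≡ᵇ 0
firstPartIsᵇ h (x ∷ _) = x ≡ᵇ h

boundedLists : ℕ → ℕ → List (List ℕ)
boundedLists zero    h = [] ∷ []
boundedLists (suc m) h = concatMap (λ x → map (x ∷_) (boundedLists m h)) (upTo (suc h))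

-- the finite set { λ ∈ 𝓑_{G₂} : ℓ(λ) = m, λ₁ = h }, enumerated
-- (every partition with λ₁ = h has all parts ≤ h)
BG2set : ℕ → ℕ → List (List ℕ)
BG2set m h = filter (λ xs → inBG2ᵇ xs ∧ firstPartIsᵇ h xs ≟ true) (boundedLists m h)

module _ {r ℓ : Level} (R : CommutativeRing r ℓ) where
  open CommutativeRing R using (Carrier; 1#; 0#) renaming (_*_ to _*R_; _+_ to _+R_)

  pow : Carrier → ℕ → Carrier
  pow x zero    = 1#
  pow x (suc n) = x *R pow x n

  -- integer power of a unit x with given inverse x⁻
  zpow : (x x⁻ : Carrier) → ℤ → Carrier
  zpow x x⁻ (+ n)     = pow x n
  zpow x x⁻ -[1+ n ]  = pow x⁻ (suc n)

  -- ω(λ) = a^{Σ⌈λ_{2i-1}/2⌉} b^{Σ⌊λ_{2i-1}/2⌋} c^{Σ⌈λ_{2i}/2⌉} d^{Σ⌊λ_{2i}/2⌋}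
  mutual
    ωodd : (a b c d : Carrier) → List ℕ → Carrier
    ωodd a b c d []       = 1#
    ωodd a b c d (x ∷ xs) = pow a ⌈ x /2⌉ *R pow b ⌊ x /2⌋ *R ωeven a b c d xs

    ωeven : (a b c d : Carrier) → List ℕ → Carrier
    ωeven a b c d []       = 1#
    ωeven a b c d (x ∷ xs) = pow c ⌈ x /2⌉ *R pow d ⌊ x /2⌋ *R ωodd a b c d xs

  ω : (a b c d : Carrier) → List ℕ → Carrier
  ω = ωodd

  sumR : List Carrier → Carrier
  sumR = foldr _+R_ 0#

  BG2 : (a b c d : Carrier) → ℕ → ℕ → Carrier
  BG2 a b c d m h = sumR (map (ω a b c d) (BG2set m h))

  qbinomℕ : Carrier → ℕ → ℕ → Carrier
  qbinomℕ q zero    zero    = 1#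
  qbinomℕ q zero    (suc k) = 0#
  qbinomℕ q (suc N) zero    = 1#
  qbinomℕ q (suc N) (suc k) = qbinomℕ q N k +R pow q (suc k) *R qbinomℕ q N (suc k)

  -- [N brack k]_Q for an integer k (zero for k < 0; zero for k > N by recursion)
  qbinom : Carrier → ℕ → ℤ → Carrier
  qbinom q N (+ k)     = qbinomℕ q N k
  qbinom q N -[1+ k ]  = 0#

-- binom(m,2) = m(m-1)/2 for any integer m (always a natural number)
choose2 : ℤ → ℕ
choose2 (+ n)      = ⌊ n * (n ∸ 1) /2⌋
choose2 -[1+ k ]   = ⌊ (suc k) * (suc (suc k)) /2⌋

module Submission where

open import Defs
open import Level using (Level)
open import Algebra.Bundles using (CommutativeMonoid; CommutativeRing; Semiring)
import Algebra.Properties.CommutativeSemigroup as CommutativeSemigroupProperties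
import Algebra.Properties.CommutativeSemiring.Exp as Exp
import Algebra.Solver.Ring.NaturalCoefficients.Default as NaturalCoefficients
open import Data.Bool.Base using (Bool; true; false; _∧_; _∨_; if_then_else_)
open import Data.Bool.Properties using (_≟_)
import Data.Bool.Properties as Bool
open import Data.Integer.Base using (+_; -[1+_]) renaming (-_ to -ℤ_; _+_ to _+ℤ_; _-_ to _-ℤ_)
import Data.Integer.Tactic.RingSolver as ℤ-Solver
open import Data.List.Base using (List; []; _∷_; map; concatMap; filter; upTo; applyUpTo; _++_; foldr)
import Data.List.Properties as List
open import Data.Nat.Base using (ℕ; zero; suc; _<_; s≤s; z≤n; _≡ᵇ_; _≤ᵇ_; ⌊_/2⌋; ⌈_/2⌉) renaming (_≤_ to _≤ℕ_; _*_ to _*ℕ_; _∸_ to _∸ℕ_; _+_ to _+ℕ_)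
import Data.Nat.Properties as ℕ
open import Data.Nat.Tactic.RingSolver using (solve-∀)
open import Data.Product.Base using (_×_; _,_)
open import Data.Sum.Base using (inj₁; inj₂)
open import Function.Base using (_∘_)
open import Relation.Binary.PropositionalEquality as ≡ using (_≡_; cong; cong₂)

-- Odd-indexed parts are even and consecutive parts differ by 1 or 2, so a partition in 𝓑_{G₂}
-- with λ₁ = 2h+2 has (λ₂, λ₃) = (2h+1, 2h) or (2h, 2h-2), and deleting λ₁, λ₂ leaves a partition
-- in 𝓑_{G₂} whose parts keep the parity of their positions. Hence
--   B(m+2, 2h+2) = a^(h+1) b^(h+1) (c^(h+1) d^h B(m, 2h) + c^h d^h B(m, 2h-2)),
-- and, B(m, 2h) vanishing for h below ⌈m/2⌉, an induction on m shows that
--   B(2k, 2(k+j)) = Q^(C(k,2) + C(j,2)) (ab)^(k+j) c^k d^j [k, j]_Q,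
--   B(2k+1, 2(k+1+j)) = Q^(C(k+1,2) + C(j,2)) (ab)^(k+1+j) c^k d^j [k, j]_Q:
-- the recursion turns into the Q-Pascal rule [n+1, j] = [n, j-1] + Q^j [n, j].
-- Rewriting (ab)^i c^k d^l = Q^i c^(k-i) d^(l-i) gives the stated form.

double : ℕ → ℕ
double zero    = zero
double (suc n) = suc (suc (double n))

double≡n+n : ∀ n → double n ≡ n +ℕ n
double≡n+n zero    = ≡.refl
double≡n+n (suc n) = cong suc (≡.trans (cong suc (double≡n+n n)) (≡.sym (ℕ.+-suc n n)))

2*n≡double : ∀ n → 2 *ℕ n ≡ double n
2*n≡double n = ≡.trans (cong (n +ℕ_) (ℕ.+-identityʳ n)) (≡.sym (double≡n+n n))

⌊double/2⌋≡n : ∀ n → ⌊ double n /2⌋ ≡ n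
⌊double/2⌋≡n n = ≡.trans (cong ⌊_/2⌋ (double≡n+n n)) (≡.sym (ℕ.n≡⌊n+n/2⌋ n))

⌊1+double/2⌋≡n : ∀ n → ⌊ suc (double n) /2⌋ ≡ n
⌊1+double/2⌋≡n zero    = ≡.refl
⌊1+double/2⌋≡n (suc n) = cong suc (⌊1+double/2⌋≡n n)

evenᵇ-double : ∀ n → evenᵇ (double n) ≡ true
evenᵇ-double zero    = ≡.refl
evenᵇ-double (suc n) = evenᵇ-double n

evenᵇ-1+double : ∀ n → evenᵇ (suc (double n)) ≡ false
evenᵇ-1+double zero    = ≡.refl
evenᵇ-1+double (suc n) = evenᵇ-1+double n

binom₂ : ℕ → ℕ
binom₂ zero    = zero
binom₂ (suc n) = n +ℕ binom₂ n

binom₂+binom₂ : ∀ n → binom₂ n +ℕ binom₂ n ≡ n *ℕ (n ∸ℕ 1)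
binom₂+binom₂ zero          = ≡.refl
binom₂+binom₂ (suc zero)    = ≡.refl
binom₂+binom₂ (suc (suc n)) = ≡.trans (regroup (suc n) (binom₂ (suc n)))
  (≡.trans (cong (suc n +ℕ suc n +ℕ_) (binom₂+binom₂ (suc n))) (expand n))
  where
  regroup : ∀ m b → (m +ℕ b) +ℕ (m +ℕ b) ≡ (m +ℕ m) +ℕ (b +ℕ b)
  regroup = solve-∀
  expand : ∀ n → (suc n +ℕ suc n) +ℕ suc n *ℕ n ≡ suc (suc n) *ℕ suc n
  expand = solve-∀

choose2-+ : ∀ n → choose2 (+ n) ≡ binom₂ n
choose2-+ n = ≡.trans (cong ⌊_/2⌋ (≡.sym (binom₂+binom₂ n))) (≡.sym (ℕ.n≡⌊n+n/2⌋ (binom₂ n)))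

≡ᵇ⇒suc-≢ᵇ : ∀ x p → (x ≡ᵇ p) ≡ true → (suc x ≡ᵇ p) ≡ false
≡ᵇ⇒suc-≢ᵇ zero    zero    _  = ≡.refl
≡ᵇ⇒suc-≢ᵇ (suc x) (suc p) eq = ≡ᵇ⇒suc-≢ᵇ x p eq

gapOKᵇ-suc : ∀ p x → gapOKᵇ (suc p) x ≡ (x ≡ᵇ p) ∨ (suc x ≡ᵇ p)
gapOKᵇ-suc zero          zero    = ≡.refl
gapOKᵇ-suc zero          (suc x) = ≡.refl
gapOKᵇ-suc (suc zero)    zero    = ≡.refl
gapOKᵇ-suc (suc (suc p)) zero    = ≡.refl
gapOKᵇ-suc (suc p)       (suc x) = gapOKᵇ-suc p x

gapOKᵇ⇒≤ᵇ : ∀ x y → gapOKᵇ x y ≡ true → (y ≤ᵇ x) ≡ true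
gapOKᵇ⇒≤ᵇ x             zero          _  = ≡.refl
gapOKᵇ⇒≤ᵇ (suc x)       (suc zero)    _  = ≡.refl
gapOKᵇ⇒≤ᵇ (suc (suc x)) (suc (suc y)) ok = gapOKᵇ⇒≤ᵇ (suc x) (suc y) ok

gapOKᵇ⇒1≤ᵇ : ∀ x y → gapOKᵇ x y ≡ true → (1 ≤ᵇ x) ≡ true
gapOKᵇ⇒1≤ᵇ (suc x) y _ = ≡.refl

gapsOKᵇ⇒decreasingᵇ : ∀ xs → gapsOKᵇ xs ≡ true → decreasingᵇ xs ≡ true
gapsOKᵇ⇒decreasingᵇ []           _  = ≡.refl
gapsOKᵇ⇒decreasingᵇ (x ∷ [])     _  = ≡.refl
gapsOKᵇ⇒decreasingᵇ (x ∷ y ∷ ys) ok = cong₂ _∧_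
  (gapOKᵇ⇒≤ᵇ x y (Bool.∧-conicalˡ _ _ ok)) (gapsOKᵇ⇒decreasingᵇ (y ∷ ys) (Bool.∧-conicalʳ _ _ ok))

gapsOKᵇ⇒allPositiveᵇ : ∀ xs → gapsOKᵇ xs ≡ true → allPositiveᵇ xs ≡ true
gapsOKᵇ⇒allPositiveᵇ []           _  = ≡.refl
gapsOKᵇ⇒allPositiveᵇ (x ∷ [])     ok = cong (_∧ true) (gapOKᵇ⇒1≤ᵇ x 0 ok)
gapsOKᵇ⇒allPositiveᵇ (x ∷ y ∷ ys) ok = cong₂ _∧_
  (gapOKᵇ⇒1≤ᵇ x y (Bool.∧-conicalˡ _ _ ok)) (gapsOKᵇ⇒allPositiveᵇ (y ∷ ys) (Bool.∧-conicalʳ _ _ ok))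

inBG2ᵇ≡ : ∀ xs → inBG2ᵇ xs ≡ oddIndexedEvenᵇ xs ∧ gapsOKᵇ xs
inBG2ᵇ≡ xs with gapsOKᵇ xs in ok
... | true  rewrite gapsOKᵇ⇒decreasingᵇ xs ok | gapsOKᵇ⇒allPositiveᵇ xs ok = ≡.refl
... | false rewrite Bool.∧-zeroʳ (oddIndexedEvenᵇ xs) = Bool.∧-zeroʳ (isPartitionᵇ xs)

-- oddTailᵇ p xs (resp. evenTailᵇ p xs): xs may follow a part p of a partition in 𝓑_{G₂}
-- when the first entry of xs sits at an odd (resp. even) position.
mutual
  oddTailᵇ : ℕ → List ℕ → Bool
  oddTailᵇ p []       = gapOKᵇ p 0
  oddTailᵇ p (x ∷ xs) = (gapOKᵇ p x ∧ evenᵇ x) ∧ evenTailᵇ x xs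

  evenTailᵇ : ℕ → List ℕ → Bool
  evenTailᵇ p []       = gapOKᵇ p 0
  evenTailᵇ p (x ∷ xs) = gapOKᵇ p x ∧ oddTailᵇ x xs

private module ∧ = CommutativeSemigroupProperties (CommutativeMonoid.commutativeSemigroup Bool.∧-commutativeMonoid)

mutual
  oddTailᵇ≡ : ∀ p xs → oddTailᵇ p xs ≡ oddIndexedEvenᵇ xs ∧ gapsOKᵇ (p ∷ xs)
  oddTailᵇ≡ p []       = ≡.refl
  oddTailᵇ≡ p (x ∷ xs) = ≡.trans (cong₂ _∧_ (Bool.∧-comm (gapOKᵇ p x) (evenᵇ x)) (evenTailᵇ≡ x xs))
    (∧.interchange (evenᵇ x) (gapOKᵇ p x) (evenIndexedSkipᵇ xs) (gapsOKᵇ (x ∷ xs)))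

  evenTailᵇ≡ : ∀ p xs → evenTailᵇ p xs ≡ evenIndexedSkipᵇ xs ∧ gapsOKᵇ (p ∷ xs)
  evenTailᵇ≡ p []       = ≡.refl
  evenTailᵇ≡ p (x ∷ xs) = ≡.trans (cong (gapOKᵇ p x ∧_) (oddTailᵇ≡ x xs))
    (∧.x∙yz≈y∙xz (gapOKᵇ p x) (oddIndexedEvenᵇ xs) (gapsOKᵇ (x ∷ xs)))

inBG2ᵇ-∷ : ∀ x xs → inBG2ᵇ (x ∷ xs) ≡ evenᵇ x ∧ evenTailᵇ x xs
inBG2ᵇ-∷ x xs = ≡.trans (inBG2ᵇ≡ (x ∷ xs))
  (≡.trans (Bool.∧-assoc (evenᵇ x) _ _) (cong (evenᵇ x ∧_) (≡.sym (evenTailᵇ≡ x xs))))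

module ListSum {c ℓ} (S : Semiring c ℓ) where
  open Semiring S
  open import Relation.Binary.Reasoning.Setoid setoid
  private module + = CommutativeSemigroupProperties +-commutativeSemigroup

  sum : List Carrier → Carrier
  sum = foldr _+_ 0#

  prev : (ℕ → Carrier) → ℕ → Carrier
  prev f zero    = 0#
  prev f (suc p) = f p

  if-* : ∀ t u v → (if t then u * v else 0#) ≈ u * (if t then v else 0#)
  if-* true  u v = refl
  if-* false u v = sym (zeroʳ u)

  if-∧ : ∀ s t (v : Carrier) → (if s ∧ t then v else 0#) ≡ (if s then (if t then v else 0#) else 0#)
  if-∧ true  t v = ≡.refl
  if-∧ false t v = ≡.refl

  if-∨ : ∀ s t v → (s ≡ true → t ≡ false) →
         (if s ∨ t then v else 0#) ≈ (if s then v else 0#) + (if t then v else 0#)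
  if-∨ true  t     v disjoint rewrite disjoint ≡.refl = sym (+-identityʳ v)
  if-∨ false true  v _ = sym (+-identityˡ v)
  if-∨ false false v _ = sym (+-identityˡ 0#)

  sum-cong : ∀ {A : Set} {f g : A → Carrier} xs → (∀ x → f x ≈ g x) → sum (map f xs) ≈ sum (map g xs)
  sum-cong []       f≈g = refl
  sum-cong (x ∷ xs) f≈g = +-cong (f≈g x) (sum-cong xs f≈g)

  sum-++ : ∀ xs ys → sum (xs ++ ys) ≈ sum xs + sum ys
  sum-++ []       ys = sym (+-identityˡ (sum ys))
  sum-++ (x ∷ xs) ys = trans (+-congˡ (sum-++ xs ys)) (sym (+-assoc x (sum xs) (sum ys)))

  sum-0# : ∀ {A : Set} (xs : List A) → sum (map (λ _ → 0#) xs) ≈ 0#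
  sum-0# []       = refl
  sum-0# (x ∷ xs) = trans (+-identityˡ _) (sum-0# xs)

  sum-+ : ∀ {A : Set} (f g : A → Carrier) xs → sum (map (λ x → f x + g x) xs) ≈ sum (map f xs) + sum (map g xs)
  sum-+ f g []       = sym (+-identityˡ 0#)
  sum-+ f g (x ∷ xs) = trans (+-congˡ (sum-+ f g xs)) (+.interchange (f x) (g x) _ _)

  sum-*ˡ : ∀ {A : Set} u (f : A → Carrier) xs → sum (map (λ x → u * f x) xs) ≈ u * sum (map f xs)
  sum-*ˡ u f []       = sym (zeroʳ u)
  sum-*ˡ u f (x ∷ xs) = trans (+-congˡ (sum-*ˡ u f xs)) (sym (distribˡ u (f x) _))

  sum-if-∧-* : ∀ {A : Set} s u (t : A → Bool) (f : A → Carrier) xs →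
    sum (map (λ x → if s ∧ t x then u * f x else 0#) xs)
    ≈ (if s then u * sum (map (λ x → if t x then f x else 0#) xs) else 0#)
  sum-if-∧-* true  u t f xs = trans (sum-cong xs (λ x → if-* (t x) u (f x))) (sum-*ˡ u _ xs)
  sum-if-∧-* false u t f xs = sum-0# xs

  sum-filter : ∀ {A : Set} (p : A → Bool) (f : A → Carrier) xs →
    sum (map f (filter (λ x → p x ≟ true) xs)) ≈ sum (map (λ x → if p x then f x else 0#) xs)
  sum-filter p f []       = refl
  sum-filter p f (x ∷ xs) with p x
  ... | true  = +-congˡ (sum-filter p f xs)
  ... | false = trans (sum-filter p f xs) (sym (+-identityˡ _))

  sum-concatMap : ∀ {A B : Set} (f : B → Carrier) (g : A → List B) xs →
    sum (map f (concatMap g xs)) ≈ sum (map (λ x → sum (map f (g x))) xs)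
  sum-concatMap f g []       = refl
  sum-concatMap f g (x ∷ xs) = begin
    sum (map f (g x ++ concatMap g xs))           ≡⟨ cong sum (List.map-++ f (g x) (concatMap g xs)) ⟩
    sum (map f (g x) ++ map f (concatMap g xs))   ≈⟨ sum-++ (map f (g x)) _ ⟩
    sum (map f (g x)) + sum (map f (concatMap g xs)) ≈⟨ +-congˡ (sum-concatMap f g xs) ⟩
    sum (map f (g x)) + sum (map (λ x → sum (map f (g x))) xs) ∎

  sum-boundedLists-suc : ∀ (f : List ℕ → Carrier) m H →
    sum (map f (boundedLists (suc m) H))
    ≈ sum (map (λ x → sum (map (λ xs → f (x ∷ xs)) (boundedLists m H))) (upTo (suc H)))
  sum-boundedLists-suc f m H = trans (sum-concatMap f (λ x → map (x ∷_) (boundedLists m H)) (upTo (suc H)))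
    (sum-cong (upTo (suc H)) (λ x → reflexive (cong sum (≡.sym (List.map-∘ {g = f} {f = x ∷_} (boundedLists m H))))))

  sum-δ : ∀ N k (f : ℕ → Carrier) → k < N → sum (map (λ x → if x ≡ᵇ k then f x else 0#) (upTo N)) ≈ f k
  sum-δ N k f k<N = trans (reflexive (cong sum (List.map-upTo _ N))) (δ N k f k<N)
    where
    δ : ∀ N k (f : ℕ → Carrier) → k < N → sum (applyUpTo (λ x → if x ≡ᵇ k then f x else 0#) N) ≈ f k
    δ (suc N) zero    f _         =
      trans (+-congˡ (trans (reflexive (cong sum (≡.sym (List.map-upTo _ N)))) (sum-0# (upTo N)))) (+-identityʳ (f 0))
    δ (suc N) (suc k) f (s≤s k<N) = trans (+-identityˡ _) (δ N k (f ∘ suc) k<N)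

  sum-gapOKᵇ : ∀ N p (f : ℕ → Carrier) → p < N →
    sum (map (λ x → if gapOKᵇ (suc p) x then f x else 0#) (upTo N)) ≈ f p + prev f p
  sum-gapOKᵇ N p f p<N = begin
    sum (map (λ x → if gapOKᵇ (suc p) x then f x else 0#) (upTo N))
      ≈⟨ sum-cong (upTo N) (λ x → trans (reflexive (cong (λ t → if t then f x else 0#) (gapOKᵇ-suc p x)))
                                       (if-∨ (x ≡ᵇ p) (suc x ≡ᵇ p) (f x) (≡ᵇ⇒suc-≢ᵇ x p))) ⟩
    sum (map (λ x → (if x ≡ᵇ p then f x else 0#) + (if suc x ≡ᵇ p then f x else 0#)) (upTo N))
      ≈⟨ sum-+ _ _ (upTo N) ⟩
    sum (map (λ x → if x ≡ᵇ p then f x else 0#) (upTo N)) + sum (map (λ x → if suc x ≡ᵇ p then f x else 0#) (upTo N))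
      ≈⟨ +-cong (sum-δ N p f p<N) (predecessor p p<N) ⟩
    f p + prev f p ∎
    where
    predecessor : ∀ p → p < N → sum (map (λ x → if suc x ≡ᵇ p then f x else 0#) (upTo N)) ≈ prev f p
    predecessor zero    _   = sum-0# (upTo N)
    predecessor (suc k) k<N = sum-δ N k f (ℕ.<⇒≤ k<N)

module Powers {r ℓ} (R : CommutativeRing r ℓ) where
  open CommutativeRing R
  open import Relation.Binary.Reasoning.Setoid setoid
  open Exp commutativeSemiring using (_^_; ^-homo-*; ^-distrib-*)
  private module * = CommutativeSemigroupProperties *-commutativeSemigroup

  pow≡^ : ∀ x n → pow R x n ≡ x ^ n
  pow≡^ x zero    = ≡.refl
  pow≡^ x (suc n) = cong (x *_) (pow≡^ x n)

  pow-+ : ∀ x m n → pow R x (m +ℕ n) ≈ pow R x m * pow R x n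
  pow-+ x m n rewrite pow≡^ x (m +ℕ n) | pow≡^ x m | pow≡^ x n = ^-homo-* x m n

  pow-distrib-* : ∀ x y n → pow R (x * y) n ≈ pow R x n * pow R y n
  pow-distrib-* x y n rewrite pow≡^ (x * y) n | pow≡^ x n | pow≡^ y n = ^-distrib-* x y n

  pow-inverse : ∀ {x y} n → x * y ≈ 1# → pow R x n * pow R y n ≈ 1#
  pow-inverse zero    _     = *-identityʳ 1#
  pow-inverse {x} {y} (suc n) x*y≈1 = begin
    x * pow R x n * (y * pow R y n)   ≈⟨ *.interchange x (pow R x n) y (pow R y n) ⟩
    x * y * (pow R x n * pow R y n)   ≈⟨ *-cong x*y≈1 (pow-inverse n x*y≈1) ⟩
    1# * 1#                           ≈⟨ *-identityʳ 1# ⟩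
    1#                                ∎

  zpow-neg : ∀ x x⁻ n → zpow R x x⁻ (-ℤ (+ n)) ≡ pow R x⁻ n
  zpow-neg x x⁻ zero    = ≡.refl
  zpow-neg x x⁻ (suc n) = ≡.refl

module WeightedCounts {r ℓ} (R : CommutativeRing r ℓ) (a b c d : CommutativeRing.Carrier R) where
  open CommutativeRing R
  open ListSum semiring
  open import Relation.Binary.Reasoning.Setoid setoid

  oddPartWeight evenPartWeight : ℕ → Carrier
  oddPartWeight  x = pow R a ⌈ x /2⌉ * pow R b ⌊ x /2⌋
  evenPartWeight x = pow R c ⌈ x /2⌉ * pow R d ⌊ x /2⌋

  -- The recursion of the header; BG2≈B₂ shows that B₂ m h = B_{G₂}(m, 2h).
  B₂ : ℕ → ℕ → Carrier
  B₂ zero          zero          = 1#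
  B₂ zero          (suc h)       = 0#
  B₂ (suc zero)    zero          = 0#
  B₂ (suc zero)    (suc zero)    = oddPartWeight 2
  B₂ (suc zero)    (suc (suc h)) = 0#
  B₂ (suc (suc m)) zero          = 0#
  B₂ (suc (suc m)) (suc h)       = oddPartWeight (double (suc h)) *
    (evenPartWeight (suc (double h)) * B₂ m h + evenPartWeight (double h) * prev (B₂ m) h)

  oddTails evenTails : ℕ → ℕ → ℕ → Carrier
  oddTails  H m p = sum (map (λ xs → if oddTailᵇ p xs then ωodd R a b c d xs else 0#) (boundedLists m H))
  evenTails H m p = sum (map (λ xs → if evenTailᵇ p xs then ωeven R a b c d xs else 0#) (boundedLists m H))

  oddTailsFrom : ℕ → ℕ → ℕ → Carrier
  oddTailsFrom H m x = if evenᵇ x then oddPartWeight x * evenTails H m x else 0#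

  oddTails-suc : ∀ H m p →
    oddTails H (suc m) p ≈ sum (map (λ x → if gapOKᵇ p x then oddTailsFrom H m x else 0#) (upTo (suc H)))
  oddTails-suc H m p = trans (sum-boundedLists-suc _ m H) (sum-cong (upTo (suc H)) λ x →
    trans (sum-if-∧-* (gapOKᵇ p x ∧ evenᵇ x) (oddPartWeight x) (evenTailᵇ x) (ωeven R a b c d) (boundedLists m H))
          (reflexive (if-∧ (gapOKᵇ p x) (evenᵇ x) _)))

  evenTails-suc : ∀ H m p →
    evenTails H (suc m) p
    ≈ sum (map (λ x → if gapOKᵇ p x then evenPartWeight x * oddTails H m x else 0#) (upTo (suc H)))
  evenTails-suc H m p = trans (sum-boundedLists-suc _ m H) (sum-cong (upTo (suc H)) λ x →
    sum-if-∧-* (gapOKᵇ p x) (evenPartWeight x) (oddTailᵇ x) (ωodd R a b c d) (boundedLists m H))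

  oddTails-zero : ∀ H m → oddTails H m 0 ≈ 0#
  oddTails-zero H zero    = +-identityˡ 0#
  oddTails-zero H (suc m) = trans (oddTails-suc H m 0) (sum-0# (upTo (suc H)))

  oddTailsFrom-1+double : ∀ H m h → oddTailsFrom H m (suc (double h)) ≡ 0#
  oddTailsFrom-1+double H m h rewrite evenᵇ-1+double h = ≡.refl

  mutual
    oddTails-1+double : ∀ H m h → suc (double h) ≤ℕ H → oddTails H m (suc (double h)) ≈ B₂ m h
    oddTails-1+double H zero    zero    _      = +-identityʳ 1#
    oddTails-1+double H zero    (suc h) _      = +-identityʳ 0#
    oddTails-1+double H (suc m) h       1+2h≤H = begin
      oddTails H (suc m) (suc (double h))
        ≈⟨ oddTails-suc H m _ ⟩
      sum (map (λ x → if gapOKᵇ (suc (double h)) x then oddTailsFrom H m x else 0#) (upTo (suc H)))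
        ≈⟨ sum-gapOKᵇ (suc H) (double h) (oddTailsFrom H m) (s≤s (ℕ.<⇒≤ 1+2h≤H)) ⟩
      oddTailsFrom H m (double h) + prev (oddTailsFrom H m) (double h)
        ≈⟨ +-cong (oddTailsFrom-double H m h (ℕ.<⇒≤ 1+2h≤H)) (odd-predecessor h) ⟩
      B₂ (suc m) h + 0#
        ≈⟨ +-identityʳ _ ⟩
      B₂ (suc m) h ∎
      where
      odd-predecessor : ∀ h → prev (oddTailsFrom H m) (double h) ≈ 0#
      odd-predecessor zero    = refl
      odd-predecessor (suc h) = reflexive (oddTailsFrom-1+double H m h)

    oddTails-2+double : ∀ H m h → double (suc h) ≤ℕ H → oddTails H m (double (suc h)) ≈ B₂ m h
    oddTails-2+double H zero    zero    _      = +-identityʳ 1#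
    oddTails-2+double H zero    (suc h) _      = +-identityʳ 0#
    oddTails-2+double H (suc m) h       2+2h≤H = begin
      oddTails H (suc m) (double (suc h))
        ≈⟨ oddTails-suc H m _ ⟩
      sum (map (λ x → if gapOKᵇ (suc (suc (double h))) x then oddTailsFrom H m x else 0#) (upTo (suc H)))
        ≈⟨ sum-gapOKᵇ (suc H) (suc (double h)) (oddTailsFrom H m) (ℕ.m≤n⇒m≤1+n 2+2h≤H) ⟩
      oddTailsFrom H m (suc (double h)) + oddTailsFrom H m (double h)
        ≈⟨ +-cong (reflexive (oddTailsFrom-1+double H m h))
                  (oddTailsFrom-double H m h (ℕ.≤-trans (ℕ.n≤1+n _) (ℕ.<⇒≤ 2+2h≤H))) ⟩
      0# + B₂ (suc m) h
        ≈⟨ +-identityˡ _ ⟩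
      B₂ (suc m) h ∎

    oddTailsFrom-double : ∀ H m h → double h ≤ℕ H → oddTailsFrom H m (double h) ≈ B₂ (suc m) h
    oddTailsFrom-double H m h 2h≤H rewrite evenᵇ-double h = evenTails-double H m h 2h≤H

    evenTails-double : ∀ H m h → double h ≤ℕ H → oddPartWeight (double h) * evenTails H m (double h) ≈ B₂ (suc m) h
    evenTails-double H zero    zero          _    = trans (*-congˡ (+-identityˡ 0#)) (zeroʳ _)
    evenTails-double H zero    (suc zero)    _    = trans (*-congˡ (+-identityʳ 1#)) (*-identityʳ _)
    evenTails-double H zero    (suc (suc h)) _    = trans (*-congˡ (+-identityˡ 0#)) (zeroʳ _)
    evenTails-double H (suc m) zero          _    =
      trans (*-congˡ (trans (evenTails-suc H m 0) (sum-0# (upTo (suc H))))) (zeroʳ _)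
    evenTails-double H (suc m) (suc h)       2h≤H = *-congˡ (begin
      evenTails H (suc m) (double (suc h))
        ≈⟨ evenTails-suc H m _ ⟩
      sum (map (λ x → if gapOKᵇ (suc (suc (double h))) x then evenPartWeight x * oddTails H m x else 0#) (upTo (suc H)))
        ≈⟨ sum-gapOKᵇ (suc H) (suc (double h)) (λ x → evenPartWeight x * oddTails H m x) (ℕ.m≤n⇒m≤1+n 2h≤H) ⟩
      evenPartWeight (suc (double h)) * oddTails H m (suc (double h)) + evenPartWeight (double h) * oddTails H m (double h)
        ≈⟨ +-cong (*-congˡ (oddTails-1+double H m h (ℕ.<⇒≤ 2h≤H)))
                  (*-congˡ (even-predecessor h (ℕ.≤-trans (ℕ.n≤1+n _) (ℕ.<⇒≤ 2h≤H)))) ⟩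
      evenPartWeight (suc (double h)) * B₂ m h + evenPartWeight (double h) * prev (B₂ m) h ∎)
      where
      even-predecessor : ∀ h → double h ≤ℕ H → oddTails H m (double h) ≈ prev (B₂ m) h
      even-predecessor zero    _    = oddTails-zero H m
      even-predecessor (suc h) 2h≤H = oddTails-2+double H m h 2h≤H

  BG2≈B₂ : ∀ m h → BG2 R a b c d m (double h) ≈ B₂ m h
  BG2≈B₂ m h = trans
    (sum-filter (λ xs → inBG2ᵇ xs ∧ firstPartIsᵇ (double h) xs) (ω R a b c d) (boundedLists m (double h)))
    (count m h)
    where
    count : ∀ m h → sum (map (λ xs → if inBG2ᵇ xs ∧ firstPartIsᵇ (double h) xs then ω R a b c d xs else 0#)
                            (boundedLists m (double h))) ≈ B₂ m h
    count zero    zero    = +-identityʳ 1#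
    count zero    (suc h) = +-identityʳ 0#
    count (suc m) h       = begin
      _ ≈⟨ sum-boundedLists-suc _ m (double h) ⟩
      sum (map (λ x → sum (map (λ xs → if inBG2ᵇ (x ∷ xs) ∧ (x ≡ᵇ double h)
                                         then oddPartWeight x * ωeven R a b c d xs else 0#)
                               (boundedLists m (double h))))
               (upTo (suc (double h))))
        ≈⟨ sum-cong (upTo (suc (double h))) (λ x → trans
             (sum-cong (boundedLists m (double h)) (λ xs → reflexive (cong (λ t → if t then _ else 0#) (head-condition x xs))))
             (trans (sum-if-∧-* ((x ≡ᵇ double h) ∧ evenᵇ x) (oddPartWeight x) (evenTailᵇ x) (ωeven R a b c d) (boundedLists m (double h)))
                    (reflexive (if-∧ (x ≡ᵇ double h) (evenᵇ x) _)))) ⟩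
      sum (map (λ x → if x ≡ᵇ double h then oddTailsFrom (double h) m x else 0#) (upTo (suc (double h))))
        ≈⟨ sum-δ (suc (double h)) (double h) (oddTailsFrom (double h) m) ℕ.≤-refl ⟩
      oddTailsFrom (double h) m (double h)
        ≈⟨ oddTailsFrom-double (double h) m h ℕ.≤-refl ⟩
      B₂ (suc m) h ∎
      where
      head-condition : ∀ x xs → inBG2ᵇ (x ∷ xs) ∧ (x ≡ᵇ double h) ≡ ((x ≡ᵇ double h) ∧ evenᵇ x) ∧ evenTailᵇ x xs
      head-condition x xs = ≡.trans (cong (_∧ (x ≡ᵇ double h)) (inBG2ᵇ-∷ x xs))
                                (∧.xy∙z≈zx∙y (evenᵇ x) (evenTailᵇ x xs) (x ≡ᵇ double h))

module ClosedForm {r ℓ} (R : CommutativeRing r ℓ) (a b c d : CommutativeRing.Carrier R) where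
  open CommutativeRing R
  open ListSum semiring using (prev)
  open Powers R
  open WeightedCounts R a b c d
  open import Relation.Binary.Reasoning.Setoid setoid
  open NaturalCoefficients commutativeSemiring using (solve; _:=_; _:+_; _:*_; con)

  monomial : ℕ → ℕ → ℕ → ℕ → Carrier
  monomial i j k l = pow R a i * pow R b j * pow R c k * pow R d l

  monomial-cong : ∀ {i j k l i′ j′ k′ l′} → i ≡ i′ → j ≡ j′ → k ≡ k′ → l ≡ l′ →
                  monomial i j k l ≈ monomial i′ j′ k′ l′
  monomial-cong ≡.refl ≡.refl ≡.refl ≡.refl = refl

  monomial-* : ∀ i j k l i′ j′ k′ l′ →
    monomial i j k l * monomial i′ j′ k′ l′ ≈ monomial (i +ℕ i′) (j +ℕ j′) (k +ℕ k′) (l +ℕ l′)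
  monomial-* i j k l i′ j′ k′ l′ = trans (regroup _ _ _ _ _ _ _ _)
    (sym (*-cong (*-cong (*-cong (pow-+ a i i′) (pow-+ b j j′)) (pow-+ c k k′)) (pow-+ d l l′)))
    where
    regroup : ∀ x y z w x′ y′ z′ w′ → x * y * z * w * (x′ * y′ * z′ * w′) ≈ x * x′ * (y * y′) * (z * z′) * (w * w′)
    regroup = solve 8 (λ x y z w x′ y′ z′ w′ →
      x :* y :* z :* w :* (x′ :* y′ :* z′ :* w′) := x :* x′ :* (y :* y′) :* (z :* z′) :* (w :* w′)) refl

  Q : Carrier
  Q = a * b * c * d

  pow-Q : ∀ k → pow R Q k ≈ monomial k k k k
  pow-Q k = trans (pow-distrib-* (a * b * c) d k)
                  (*-congʳ (trans (pow-distrib-* (a * b) c k) (*-congʳ (pow-distrib-* a b k))))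

  oddPartWeight-double : ∀ s → oddPartWeight (double s) ≈ monomial s s 0 0
  oddPartWeight-double s rewrite ⌊1+double/2⌋≡n s | ⌊double/2⌋≡n s = sym (trans (*-identityʳ _) (*-identityʳ _))

  evenPartWeight-double : ∀ s → evenPartWeight (double s) ≈ monomial 0 0 s s
  evenPartWeight-double s rewrite ⌊1+double/2⌋≡n s | ⌊double/2⌋≡n s =
    sym (*-congʳ (trans (*-congʳ (*-identityˡ 1#)) (*-identityˡ _)))

  evenPartWeight-1+double : ∀ s → evenPartWeight (suc (double s)) ≈ monomial 0 0 (suc s) s
  evenPartWeight-1+double s rewrite ⌊double/2⌋≡n s | ⌊1+double/2⌋≡n s =
    sym (*-congʳ (trans (*-congʳ (*-identityˡ 1#)) (*-identityˡ _)))

  stepWeights-odd : ∀ s i j k l → oddPartWeight (double (suc s)) * evenPartWeight (suc (double s)) * monomial i j k l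
                                  ≈ monomial (suc s +ℕ 0 +ℕ i) (suc s +ℕ 0 +ℕ j) (suc s +ℕ k) (s +ℕ l)
  stepWeights-odd s i j k l = begin
    oddPartWeight (double (suc s)) * evenPartWeight (suc (double s)) * monomial i j k l
      ≈⟨ *-congʳ (*-cong (oddPartWeight-double (suc s)) (evenPartWeight-1+double s)) ⟩
    monomial (suc s) (suc s) 0 0 * monomial 0 0 (suc s) s * monomial i j k l
      ≈⟨ trans (*-congʳ (monomial-* (suc s) (suc s) 0 0 0 0 (suc s) s)) (monomial-* (suc s +ℕ 0) (suc s +ℕ 0) (suc s) s i j k l) ⟩
    monomial (suc s +ℕ 0 +ℕ i) (suc s +ℕ 0 +ℕ j) (suc s +ℕ k) (s +ℕ l) ∎

  stepWeights-even : ∀ s i j k l → oddPartWeight (double (suc s)) * evenPartWeight (double s) * monomial i j k l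
                                   ≈ monomial (suc s +ℕ 0 +ℕ i) (suc s +ℕ 0 +ℕ j) (s +ℕ k) (s +ℕ l)
  stepWeights-even s i j k l = begin
    oddPartWeight (double (suc s)) * evenPartWeight (double s) * monomial i j k l
      ≈⟨ *-congʳ (*-cong (oddPartWeight-double (suc s)) (evenPartWeight-double s)) ⟩
    monomial (suc s) (suc s) 0 0 * monomial 0 0 s s * monomial i j k l
      ≈⟨ trans (*-congʳ (monomial-* (suc s) (suc s) 0 0 0 0 s s)) (monomial-* (suc s +ℕ 0) (suc s +ℕ 0) s s i j k l) ⟩
    monomial (suc s +ℕ 0 +ℕ i) (suc s +ℕ 0 +ℕ j) (s +ℕ k) (s +ℕ l) ∎

  closedMonomial : ℕ → ℕ → ℕ → Carrier
  closedMonomial k n j = monomial (binom₂ k +ℕ binom₂ j +ℕ k +ℕ j) (binom₂ k +ℕ binom₂ j +ℕ k +ℕ j)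
                                  (binom₂ k +ℕ binom₂ j +ℕ n) (binom₂ k +ℕ binom₂ j +ℕ j)

  closed : ℕ → ℕ → ℕ → Carrier
  closed k n j = closedMonomial k n j * qbinomℕ R Q n j

  step : ℕ → (ℕ → Carrier) → ℕ → Carrier
  step k C j = oddPartWeight (double (suc (k +ℕ j))) *
    (evenPartWeight (suc (double (k +ℕ j))) * C j + evenPartWeight (double (k +ℕ j)) * prev C j)

  step-closedMonomial-odd : ∀ k n j →
    oddPartWeight (double (suc (k +ℕ j))) * evenPartWeight (suc (double (k +ℕ j))) * closedMonomial k n j
    ≈ closedMonomial (suc k) (suc n) j * pow R Q j
  step-closedMonomial-odd k n j =
    trans (stepWeights-odd (k +ℕ j) A A C D)
          (trans (monomial-cong (exp-ab k bk j bj) (exp-ab k bk j bj) (exp-c k bk j bj n) (exp-d k bk j bj))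
                 (sym (trans (*-congˡ (pow-Q j)) (monomial-* A′ A′ C′ D′ j j j j))))
    where
    bk bj A C D A′ C′ D′ : ℕ
    bk = binom₂ k
    bj = binom₂ j
    A  = bk +ℕ bj +ℕ k +ℕ j
    C  = bk +ℕ bj +ℕ n
    D  = bk +ℕ bj +ℕ j
    A′ = k +ℕ bk +ℕ bj +ℕ suc k +ℕ j
    C′ = k +ℕ bk +ℕ bj +ℕ suc n
    D′ = k +ℕ bk +ℕ bj +ℕ j
    exp-ab : ∀ k bk j bj → suc (k +ℕ j) +ℕ 0 +ℕ (bk +ℕ bj +ℕ k +ℕ j) ≡ k +ℕ bk +ℕ bj +ℕ suc k +ℕ j +ℕ j
    exp-ab = solve-∀
    exp-c : ∀ k bk j bj n → suc (k +ℕ j) +ℕ (bk +ℕ bj +ℕ n) ≡ k +ℕ bk +ℕ bj +ℕ suc n +ℕ j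
    exp-c = solve-∀
    exp-d : ∀ k bk j bj → k +ℕ j +ℕ (bk +ℕ bj +ℕ j) ≡ k +ℕ bk +ℕ bj +ℕ j +ℕ j
    exp-d = solve-∀

  step-closedMonomial-even : ∀ k n j →
    oddPartWeight (double (suc (k +ℕ suc j))) * evenPartWeight (double (k +ℕ suc j)) * closedMonomial k n j
    ≈ closedMonomial (suc k) (suc n) (suc j)
  step-closedMonomial-even k n j =
    trans (stepWeights-even (k +ℕ suc j) A A C D)
          (monomial-cong (exp-ab k bk j bj) (exp-ab k bk j bj) (exp-c k bk j bj n) (exp-d k bk j bj))
    where
    bk bj A C D : ℕ
    bk = binom₂ k
    bj = binom₂ j
    A  = bk +ℕ bj +ℕ k +ℕ j
    C  = bk +ℕ bj +ℕ n
    D  = bk +ℕ bj +ℕ j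
    exp-ab : ∀ k bk j bj → suc (k +ℕ suc j) +ℕ 0 +ℕ (bk +ℕ bj +ℕ k +ℕ j) ≡ k +ℕ bk +ℕ (j +ℕ bj) +ℕ suc k +ℕ suc j
    exp-ab = solve-∀
    exp-c : ∀ k bk j bj n → k +ℕ suc j +ℕ (bk +ℕ bj +ℕ n) ≡ k +ℕ bk +ℕ (j +ℕ bj) +ℕ suc n
    exp-c = solve-∀
    exp-d : ∀ k bk j bj → k +ℕ suc j +ℕ (bk +ℕ bj +ℕ j) ≡ k +ℕ bk +ℕ (j +ℕ bj) +ℕ suc j
    exp-d = solve-∀

  qbinomℕ-zero : ∀ n → qbinomℕ R Q n 0 ≡ 1#
  qbinomℕ-zero zero    = ≡.refl
  qbinomℕ-zero (suc n) = ≡.refl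

  -- closed (suc k) (suc n) (suc j) unfolds by the Q-Pascal rule [n+1, j+1] = [n, j] + Q^(j+1) [n, j+1].
  step-closed : ∀ k n j → step k (closed k n) j ≈ closed (suc k) (suc n) j
  step-closed k n zero = begin
    o * (e₁ * (M * q) + e₀ * 0#) ≈⟨ collect o e₁ e₀ M q ⟩
    o * e₁ * M * q               ≈⟨ *-congʳ (step-closedMonomial-odd k n 0) ⟩
    M′ * 1# * q                  ≈⟨ trans (*-congʳ (*-identityʳ M′)) (*-congˡ (reflexive (qbinomℕ-zero n))) ⟩
    closed (suc k) (suc n) 0     ∎
    where
    o e₁ e₀ M M′ q : Carrier
    o  = oddPartWeight (double (suc (k +ℕ 0)))
    e₁ = evenPartWeight (suc (double (k +ℕ 0)))
    e₀ = evenPartWeight (double (k +ℕ 0))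
    M  = closedMonomial k n 0
    M′ = closedMonomial (suc k) (suc n) 0
    q  = qbinomℕ R Q n 0
    collect : ∀ o e₁ e₀ M q → o * (e₁ * (M * q) + e₀ * 0#) ≈ o * e₁ * M * q
    collect = solve 5 (λ o e₁ e₀ M q → o :* (e₁ :* (M :* q) :+ e₀ :* con 0) := o :* e₁ :* M :* q) refl
  step-closed k n (suc j) = begin
    o * (e₁ * (M₁ * q₁) + e₀ * (M₀ * q₀)) ≈⟨ collect o e₁ e₀ M₁ q₁ M₀ q₀ ⟩
    o * e₁ * M₁ * q₁ + o * e₀ * M₀ * q₀   ≈⟨ +-cong (*-congʳ (step-closedMonomial-odd k n (suc j)))
                                                    (*-congʳ (step-closedMonomial-even k n j)) ⟩
    M′ * pow R Q (suc j) * q₁ + M′ * q₀   ≈⟨ factor M′ (pow R Q (suc j)) q₁ q₀ ⟩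
    closed (suc k) (suc n) (suc j)        ∎
    where
    o e₁ e₀ M₁ M₀ M′ q₁ q₀ : Carrier
    o  = oddPartWeight (double (suc (k +ℕ suc j)))
    e₁ = evenPartWeight (suc (double (k +ℕ suc j)))
    e₀ = evenPartWeight (double (k +ℕ suc j))
    M₁ = closedMonomial k n (suc j)
    M₀ = closedMonomial k n j
    M′ = closedMonomial (suc k) (suc n) (suc j)
    q₁ = qbinomℕ R Q n (suc j)
    q₀ = qbinomℕ R Q n j
    collect : ∀ o e₁ e₀ M₁ q₁ M₀ q₀ → o * (e₁ * (M₁ * q₁) + e₀ * (M₀ * q₀)) ≈ o * e₁ * M₁ * q₁ + o * e₀ * M₀ * q₀
    collect = solve 7 (λ o e₁ e₀ M₁ q₁ M₀ q₀ →
      o :* (e₁ :* (M₁ :* q₁) :+ e₀ :* (M₀ :* q₀)) := o :* e₁ :* M₁ :* q₁ :+ o :* e₀ :* M₀ :* q₀) refl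
    factor : ∀ M P q₁ q₀ → M * P * q₁ + M * q₀ ≈ M * (q₀ + P * q₁)
    factor = solve 4 (λ M P q₁ q₀ → M :* P :* q₁ :+ M :* q₀ := M :* (q₀ :+ P :* q₁)) refl

  record Profile (m k : ℕ) (C : ℕ → Carrier) : Set ℓ where
    field
      below : ∀ h → h < k → B₂ m h ≈ 0#
      from  : ∀ j → B₂ m (k +ℕ j) ≈ C j
  open Profile

  Profile-cong : ∀ {m k C C′} → (∀ j → C j ≈ C′ j) → Profile m k C → Profile m k C′
  Profile-cong C≈C′ p = record { below = below p ; from = λ j → trans (from p j) (C≈C′ j) }

  Profile-step : ∀ {m k C} → Profile m k C → Profile (suc (suc m)) (suc k) (step k C)
  Profile-step {m} {k} {C} p = record { below = below′ ; from = from′ }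
    where
    prev-below : ∀ h → h ≤ℕ k → prev (B₂ m) h ≈ 0#
    prev-below zero    _   = refl
    prev-below (suc h) h<k = below p h h<k
    below′ : ∀ h → h < suc k → B₂ (suc (suc m)) h ≈ 0#
    below′ zero    _         = refl
    below′ (suc h) (s≤s h<k) = begin
      w₀ * (w₁ * B₂ m h + w₂ * prev (B₂ m) h)
        ≈⟨ *-congˡ (+-cong (*-congˡ (below p h h<k)) (*-congˡ (prev-below h (ℕ.<⇒≤ h<k)))) ⟩
      w₀ * (w₁ * 0# + w₂ * 0#)
        ≈⟨ *-congˡ (trans (+-cong (zeroʳ w₁) (zeroʳ w₂)) (+-identityʳ 0#)) ⟩
      w₀ * 0#
        ≈⟨ zeroʳ w₀ ⟩
      0# ∎
      where
      w₀ w₁ w₂ : Carrier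
      w₀ = oddPartWeight (double (suc h))
      w₁ = evenPartWeight (suc (double h))
      w₂ = evenPartWeight (double h)
    prev-from : ∀ j → prev (B₂ m) (k +ℕ j) ≈ prev C j
    prev-from zero    = prev-below (k +ℕ 0) (ℕ.≤-reflexive (ℕ.+-identityʳ k))
    prev-from (suc j) = trans (reflexive (cong (prev (B₂ m)) (ℕ.+-suc k j))) (from p j)
    from′ : ∀ j → B₂ (suc (suc m)) (suc k +ℕ j) ≈ step k C j
    from′ j = *-congˡ (+-cong (*-congˡ (from p j)) (*-congˡ (prev-from j)))

  profile-even : ∀ n → Profile (double n) n (closed n n)
  profile-even zero    = record { below = λ _ () ; from = from₀ }
    where
    from₀ : ∀ j → B₂ 0 j ≈ closed 0 0 j
    from₀ zero    = sym (trans (*-identityʳ _) (trans (*-identityʳ _) (trans (*-identityʳ _) (*-identityʳ _))))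
    from₀ (suc j) = sym (zeroʳ _)
  profile-even (suc n) = Profile-cong (step-closed n n) (Profile-step (profile-even n))

  profile-odd : ∀ n → Profile (suc (double n)) (suc n) (closed (suc n) n)
  profile-odd zero    = record { below = below₁ ; from = from₁ }
    where
    below₁ : ∀ h → h < 1 → B₂ 1 h ≈ 0#
    below₁ zero    _          = refl
    below₁ (suc h) (s≤s ())
    from₁ : ∀ j → B₂ 1 (suc j) ≈ closed 1 0 j
    from₁ zero    = sym (trans (*-identityʳ _) (trans (*-identityʳ _) (*-identityʳ _)))
    from₁ (suc j) = sym (zeroʳ _)
  profile-odd (suc n) = Profile-cong (step-closed (suc n) n) (Profile-step (profile-odd n))

+[m+n]-+m≡+n : ∀ m n → + (m +ℕ n) -ℤ + m ≡ + n
+[m+n]-+m≡+n m n = lemma (+ m) (+ n)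
  where
  lemma : ∀ x y → (x +ℤ y) -ℤ x ≡ y
  lemma = ℤ-Solver.solve-∀

+m-+[m+n]≡-+n : ∀ m n → + m -ℤ + (m +ℕ n) ≡ -ℤ (+ n)
+m-+[m+n]≡-+n m n = lemma (+ m) (+ n)
  where
  lemma : ∀ x y → x -ℤ (x +ℤ y) ≡ -ℤ y
  lemma = ℤ-Solver.solve-∀

+m-+[m+n]-1≡-[1+n] : ∀ m n → (+ m -ℤ + (m +ℕ n)) -ℤ + 1 ≡ -[1+ n ]
+m-+[m+n]-1≡-[1+n] m n = lemma (+ m) (+ n)
  where
  lemma : ∀ x y → (x -ℤ (x +ℤ y)) -ℤ + 1 ≡ -ℤ (+ 1 +ℤ y)
  lemma = ℤ-Solver.solve-∀

module Evaluation {r ℓ} (R : CommutativeRing r ℓ) (a b c d c⁻ d⁻ : CommutativeRing.Carrier R)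
  (c*c⁻≈1 : CommutativeRing._≈_ R (CommutativeRing._*_ R c c⁻) (CommutativeRing.1# R))
  (d*d⁻≈1 : CommutativeRing._≈_ R (CommutativeRing._*_ R d d⁻) (CommutativeRing.1# R)) where
  open CommutativeRing R
  open Powers R
  open WeightedCounts R a b c d
  open ClosedForm R a b c d
  open import Relation.Binary.Reasoning.Setoid setoid
  open NaturalCoefficients commutativeSemiring using (solve; _:=_; _:*_)

  oddFormula evenFormula : ℕ → ℕ → Carrier
  oddFormula n h = pow R Q (choose2 (+ (n +ℕ 1)) +ℕ choose2 ((+ h -ℤ + n) +ℤ + 1))
    * zpow R c c⁻ ((+ n -ℤ + h) -ℤ + 1) * zpow R d d⁻ (-ℤ (+ n)) * qbinom R Q (n ∸ℕ 1) (+ h -ℤ + n)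
  evenFormula n h = pow R Q (choose2 (+ (n +ℕ 1)) +ℕ choose2 ((+ h -ℤ + n) +ℤ + 1))
    * zpow R c c⁻ (+ n -ℤ + h) * zpow R d d⁻ (-ℤ (+ n)) * qbinom R Q n (+ h -ℤ + n)

  monomial-cancel : ∀ A B C D u v → monomial A B (C +ℕ u) (D +ℕ v) * pow R c⁻ u * pow R d⁻ v ≈ monomial A B C D
  monomial-cancel A B C D u v = begin
    pow R a A * pow R b B * pow R c (C +ℕ u) * pow R d (D +ℕ v) * pow R c⁻ u * pow R d⁻ v
      ≈⟨ *-congʳ (*-congʳ (*-cong (*-congˡ (pow-+ c C u)) (pow-+ d D v))) ⟩
    pow R a A * pow R b B * (pow R c C * pow R c u) * (pow R d D * pow R d v) * pow R c⁻ u * pow R d⁻ v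
      ≈⟨ regroup (pow R a A) (pow R b B) (pow R c C) (pow R c u) (pow R d D) (pow R d v) (pow R c⁻ u) (pow R d⁻ v) ⟩
    monomial A B C D * ((pow R c u * pow R c⁻ u) * (pow R d v * pow R d⁻ v))
      ≈⟨ *-congˡ (trans (*-cong (pow-inverse u c*c⁻≈1) (pow-inverse v d*d⁻≈1)) (*-identityʳ 1#)) ⟩
    monomial A B C D * 1#
      ≈⟨ *-identityʳ _ ⟩
    monomial A B C D ∎
    where
    regroup : ∀ x y z z′ w w′ z⁻ w⁻ → x * y * (z * z′) * (w * w′) * z⁻ * w⁻ ≈ x * y * z * w * (z′ * z⁻ * (w′ * w⁻))
    regroup = solve 8 (λ x y z z′ w w′ z⁻ w⁻ →
      x :* y :* (z :* z′) :* (w :* w′) :* z⁻ :* w⁻ := x :* y :* z :* w :* (z′ :* z⁻ :* (w′ :* w⁻))) refl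

  monomial≈Q-power : ∀ e A C D u v q → e ≡ A → e ≡ C +ℕ u → e ≡ D +ℕ v →
                     monomial A A C D * q ≈ pow R Q e * pow R c⁻ u * pow R d⁻ v * q
  monomial≈Q-power e A C D u v q e≡A e≡C+u e≡D+v = *-congʳ (sym (begin
    pow R Q e * pow R c⁻ u * pow R d⁻ v
      ≈⟨ *-congʳ (*-congʳ (pow-Q e)) ⟩
    monomial e e e e * pow R c⁻ u * pow R d⁻ v
      ≈⟨ *-congʳ (*-congʳ (monomial-cong e≡A e≡A e≡C+u e≡D+v)) ⟩
    monomial A A (C +ℕ u) (D +ℕ v) * pow R c⁻ u * pow R d⁻ v
      ≈⟨ monomial-cancel A A C D u v ⟩
    monomial A A C D ∎))

  qbinom-below : ∀ N {h n} → h < n → qbinom R Q N (+ h -ℤ + n) ≡ 0#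
  qbinom-below N {h} h<n with ℕ.m≤n⇒∃[o]m+o≡n h<n
  ... | o , ≡.refl = cong (qbinom R Q N)
    (≡.trans (cong (λ n → + h -ℤ + n) (≡.sym (ℕ.+-suc h o))) (+m-+[m+n]≡-+n h (suc o)))

  *-qbinom-below : ∀ x N {h n} → h < n → x * qbinom R Q N (+ h -ℤ + n) ≈ 0#
  *-qbinom-below x N h<n = trans (*-congˡ (reflexive (qbinom-below N h<n))) (zeroʳ x)

  Q-exponent : ∀ n j → choose2 (+ (n +ℕ 1)) +ℕ choose2 ((+ (n +ℕ j) -ℤ + n) +ℤ + 1) ≡ binom₂ (suc n) +ℕ binom₂ (suc j)
  Q-exponent n j = cong₂ _+ℕ_ (≡.trans (choose2-+ (n +ℕ 1)) (cong binom₂ (ℕ.+-comm n 1)))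
    (≡.trans (cong (λ z → choose2 (z +ℤ + 1)) (+[m+n]-+m≡+n n j))
             (≡.trans (choose2-+ (j +ℕ 1)) (cong binom₂ (ℕ.+-comm j 1))))

  evenFormula-above : ∀ n j → evenFormula n (n +ℕ j) ≡
    pow R Q (binom₂ (suc n) +ℕ binom₂ (suc j)) * pow R c⁻ j * pow R d⁻ n * qbinomℕ R Q n j
  evenFormula-above n j = cong₂ _*_
    (cong₂ _*_ (cong₂ _*_ (cong (pow R Q) (Q-exponent n j))
                          (≡.trans (cong (zpow R c c⁻) (+m-+[m+n]≡-+n n j)) (zpow-neg c c⁻ j)))
               (zpow-neg d d⁻ n))
    (cong (qbinom R Q n) (+[m+n]-+m≡+n n j))

  oddFormula-above : ∀ k j → oddFormula (suc k) (suc k +ℕ j) ≡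
    pow R Q (binom₂ (suc (suc k)) +ℕ binom₂ (suc j)) * pow R c⁻ (suc j) * pow R d⁻ (suc k) * qbinomℕ R Q k j
  oddFormula-above k j = cong₂ _*_
    (cong₂ _*_ (cong₂ _*_ (cong (pow R Q) (Q-exponent (suc k) j))
                          (cong (zpow R c c⁻) (+m-+[m+n]-1≡-[1+n] (suc k) j)))
               (zpow-neg d d⁻ (suc k)))
    (cong (qbinom R Q k) (+[m+n]-+m≡+n (suc k) j))

  B₂-even : ∀ n h → B₂ (double n) h ≈ evenFormula n h
  B₂-even n h with ℕ.<-≤-connex h n
  ... | inj₁ h<n = trans (Profile.below (profile-even n) h h<n) (sym (*-qbinom-below _ n h<n))
  ... | inj₂ n≤h with ℕ.m≤n⇒∃[o]m+o≡n n≤h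
  ...   | j , ≡.refl = begin
    B₂ (double n) (n +ℕ j)   ≈⟨ Profile.from (profile-even n) j ⟩
    closed n n j             ≈⟨ monomial≈Q-power _ _ _ _ j n _ (exp-a n bn j bj) (exp-a n bn j bj) (exp-d n bn j bj) ⟩
    pow R Q (binom₂ (suc n) +ℕ binom₂ (suc j)) * pow R c⁻ j * pow R d⁻ n * qbinomℕ R Q n j
                             ≡⟨ ≡.sym (evenFormula-above n j) ⟩
    evenFormula n (n +ℕ j)   ∎
    where
    bn bj : ℕ
    bn = binom₂ n
    bj = binom₂ j
    exp-a : ∀ n bn j bj → n +ℕ bn +ℕ (j +ℕ bj) ≡ bn +ℕ bj +ℕ n +ℕ j
    exp-a = solve-∀
    exp-d : ∀ n bn j bj → n +ℕ bn +ℕ (j +ℕ bj) ≡ bn +ℕ bj +ℕ j +ℕ n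
    exp-d = solve-∀

  B₂-odd : ∀ k h → B₂ (suc (double k)) h ≈ oddFormula (suc k) h
  B₂-odd k h with ℕ.<-≤-connex h (suc k)
  ... | inj₁ h<n = trans (Profile.below (profile-odd k) h h<n) (sym (*-qbinom-below _ k h<n))
  ... | inj₂ n≤h with ℕ.m≤n⇒∃[o]m+o≡n n≤h
  ...   | j , ≡.refl = begin
    B₂ (suc (double k)) (suc k +ℕ j)   ≈⟨ Profile.from (profile-odd k) j ⟩
    closed (suc k) k j                 ≈⟨ monomial≈Q-power _ _ _ _ (suc j) (suc k) _
                                            (exp-a k bk j bj) (exp-c k bk j bj) (exp-d k bk j bj) ⟩
    pow R Q (binom₂ (suc (suc k)) +ℕ binom₂ (suc j)) * pow R c⁻ (suc j) * pow R d⁻ (suc k) * qbinomℕ R Q k j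
                                       ≡⟨ ≡.sym (oddFormula-above k j) ⟩
    oddFormula (suc k) (suc k +ℕ j)    ∎
    where
    bk bj : ℕ
    bk = binom₂ k
    bj = binom₂ j
    exp-a : ∀ k bk j bj → suc k +ℕ (k +ℕ bk) +ℕ (j +ℕ bj) ≡ k +ℕ bk +ℕ bj +ℕ suc k +ℕ j
    exp-a = solve-∀
    exp-c : ∀ k bk j bj → suc k +ℕ (k +ℕ bk) +ℕ (j +ℕ bj) ≡ k +ℕ bk +ℕ bj +ℕ k +ℕ suc j
    exp-c = solve-∀
    exp-d : ∀ k bk j bj → suc k +ℕ (k +ℕ bk) +ℕ (j +ℕ bj) ≡ k +ℕ bk +ℕ bj +ℕ j +ℕ suc k
    exp-d = solve-∀

  BG2-odd : ∀ k h → BG2 R a b c d (2 *ℕ suc k ∸ℕ 1) (2 *ℕ h) ≈ oddFormula (suc k) h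
  BG2-odd k h = begin
    BG2 R a b c d (2 *ℕ suc k ∸ℕ 1) (2 *ℕ h) ≡⟨ cong₂ (BG2 R a b c d) (cong (_∸ℕ 1) (2*n≡double (suc k))) (2*n≡double h) ⟩
    BG2 R a b c d (suc (double k)) (double h) ≈⟨ BG2≈B₂ (suc (double k)) h ⟩
    B₂ (suc (double k)) h                     ≈⟨ B₂-odd k h ⟩
    oddFormula (suc k) h                      ∎

  BG2-even : ∀ n h → BG2 R a b c d (2 *ℕ n) (2 *ℕ h) ≈ evenFormula n h
  BG2-even n h = begin
    BG2 R a b c d (2 *ℕ n) (2 *ℕ h)   ≡⟨ cong₂ (BG2 R a b c d) (2*n≡double n) (2*n≡double h) ⟩
    BG2 R a b c d (double n) (double h) ≈⟨ BG2≈B₂ (double n) h ⟩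
    B₂ (double n) h                   ≈⟨ B₂-even n h ⟩
    evenFormula n h                   ∎

mainTheorem7 : ∀ {r ℓ : Level} (R : CommutativeRing r ℓ) →
    let open CommutativeRing R in
    (a b c d c⁻ d⁻ : Carrier) → c * c⁻ ≈ 1# → d * d⁻ ≈ 1# →
    (n h : ℕ) → 1 ≤ℕ n → 1 ≤ℕ h →
      (BG2 R a b c d (2 *ℕ n ∸ℕ 1) (2 *ℕ h)
        ≈ pow R (a * b * c * d) (choose2 (+ (n +ℕ 1)) +ℕ choose2 ((+ h -ℤ + n) +ℤ + 1))
          * zpow R c c⁻ ((+ n -ℤ + h) -ℤ + 1)
          * zpow R d d⁻ (-ℤ (+ n))
          * qbinom R (a * b * c * d) (n ∸ℕ 1) (+ h -ℤ + n))
      ×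
      (BG2 R a b c d (2 *ℕ n) (2 *ℕ h)
        ≈ pow R (a * b * c * d) (choose2 (+ (n +ℕ 1)) +ℕ choose2 ((+ h -ℤ + n) +ℤ + 1))
          * zpow R c c⁻ (+ n -ℤ + h)
          * zpow R d d⁻ (-ℤ (+ n))
          * qbinom R (a * b * c * d) n (+ h -ℤ + n))
mainTheorem7 R a b c d c⁻ d⁻ c*c⁻≈1 d*d⁻≈1 (suc k) h (s≤s z≤n) _ = BG2-odd k h , BG2-even (suc k) h
  where open Evaluation R a b c d c⁻ d⁻ c*c⁻≈1 d*d⁻≈1
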